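{- Let $q,m,t$ be positive integers with $q\ge 3$ and $t<q$. In every proper $q$-coloring of $G_{m,t}$, all cliques $C_1,\dots,C_m$ are colored by the same set of $q-1$ colors and all vertices of the independent sets $I_1,\dots,I_m$ receive the remaining color. The same holds for $C_1',\dots,C_m'$ and $I_1',\dots,I_m'$.
   Context: The graph $G_{m,t}$ consists of cliques $C_1,\dots,C_m,C_1',\dots,C_m'$ each of size $q-1$, independent sets $I_1,\dots,I_m,I_1',\dots,I_m'$ each of size $t$ (with a fixed ordering of the vertices of each), and further vertices $s_1,\dots,s_m$, all disjoint. Its edges are: the edges inside each clique; for $1\le i\le m$ all edges between $C_i$ and $I_i$; for $2\le i\le m$, $C_i$ is partitioned into $t$ disjoint subsets $C_{i,1},\dots,C_{i,t}$ each of size $\lfloor (q-1)/t\rfloor$ or $\lceil (q-1)/t\rceil$, and the $j$-th vertex of $I_{i-1}$ is joined to every vertex of $C_{i,j}$; the same edges between the $C_i'$ and $I_i'$ defined identically; and for each $i$, $s_i$ is adjacent to exactly one vertex of $I_i$ and exactly one vertex of $I_i'$. No other edges. -}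

module Defs where

open import Data.Nat using (ℕ; zero; suc; _+_; _∸_; _/_; NonZero)
open import Data.Fin using (Fin; toℕ)
open import Data.Fin.Properties using (_≟_)
open import Data.Bool using (Bool)
open import Data.List using (length; filter)
open import Data.List.Base using (allFin)
open import Data.Sum using (_⊎_)
open import Relation.Binary.PropositionalEquality using (_≡_; _≢_)

⌈_/_⌉ : (n t : ℕ) .{{_ : NonZero t}} → ℕ
⌈ n / t ⌉ = (n + (t ∸ 1)) / t

-- Vertices of G_{m,t} (q is the number of colours, cliques have size q-1).
-- The Bool flag selects the unprimed (false) or primed (true) copy.
-- Indices i : Fin m represent 1..m (toℕ i = i-1).
data V (m t q : ℕ) : Set where
  C : Bool → Fin m → Fin (q ∸ 1) → V m t q
  I : Bool → Fin m → Fin t → V m t q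
  S : Fin m → V m t q

-- Directed edge relation; the graph's adjacency is its symmetric closure.
-- part b i k = j  means vertex k of C_i (resp. C_i') lies in C_{i,j}.
-- sn b i       = the unique neighbour of s_i in I_i (b = false) / I_i' (b = true).
data E {m t q : ℕ} (part : Bool → Fin m → Fin (q ∸ 1) → Fin t)
       (sn : Bool → Fin m → Fin t) : V m t q → V m t q → Set where
  cc : ∀ b i k k' → k ≢ k' → E part sn (C b i k) (C b i k')
  ci : ∀ b i k j → E part sn (C b i k) (I b i j)
  ic : ∀ b i i' j k → toℕ i' ≡ suc (toℕ i) → part b i' k ≡ j →
       E part sn (I b i j) (C b i' k)
  si : ∀ b i → E part sn (S i) (I b i (sn b i))

Adj : {m t q : ℕ} (part : Bool → Fin m → Fin (q ∸ 1) → Fin t)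
      (sn : Bool → Fin m → Fin t) → V m t q → V m t q → Set
Adj part sn u v = E part sn u v ⊎ E part sn v u

classSize : {t : ℕ} (n : ℕ) → (Fin n → Fin t) → Fin t → ℕ
classSize n p j = length (filter (λ k → p k ≟ j) (allFin n))

Balanced : (m t q : ℕ) .{{_ : NonZero t}} →
           (Bool → Fin m → Fin (q ∸ 1) → Fin t) → Set
Balanced m t q part =
  ∀ b (i : Fin m) → 1 Data.Nat.≤ toℕ i → ∀ (j : Fin t) →
    (classSize (q ∸ 1) (part b i) j ≡ (q ∸ 1) / t) ⊎ (classSize (q ∸ 1) (part b i) j ≡ ⌈ q ∸ 1 / t ⌉)

Proper : {m t q : ℕ} (part : Bool → Fin m → Fin (q ∸ 1) → Fin t)
         (sn : Bool → Fin m → Fin t) → (V m t q → Fin q) → Set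
Proper part sn c = ∀ u v → Adj part sn u v → c u ≢ c v

module Submission where

open import Defs
open import Data.Nat using (ℕ; _≤_; _<_; _∸_; NonZero; zero; suc; s≤s; z≤n)
open import Data.Nat.Properties using (n≮n)
open import Data.Fin using (Fin; toℕ; punchOut)
import Data.Fin as Fin
open import Data.Fin.Properties
  using (_≟_; any?; all?; injective⇒≤; punchOut-injective; toℕ-inject₁)
open import Data.Fin.Induction using (<-weakInduction)
open import Data.Bool using (Bool)
open import Data.Product using (∃; _×_; _,_; proj₁; proj₂)
open import Data.Sum using (inj₁)
open import Function using (_∘_)
open import Function.Definitions using (Injective)
open import Relation.Nullary using (yes; no; ¬?; contradiction)
open import Relation.Binary.PropositionalEquality using (_≡_; _≢_; refl; sym; trans; cong)

-- A proper colouring is injective on the clique C_i of size q - 1, which therefore avoids exactly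
-- one of the q colours, a_i; every vertex of I_i is adjacent to all of C_i, so it is coloured a_i.
-- Every vertex of C_{i+1} has a neighbour in I_i, so C_{i+1} avoids a_i too, i.e. a_{i+1} = a_i;
-- by induction all the cliques avoid the same colour.

Avoids : ∀ {m n} → (Fin m → Fin n) → Fin n → Set
Avoids f y = ∀ k → f k ≢ y

module _ {m n : ℕ} {f : Fin m → Fin (suc n)} {y : Fin (suc n)} (avoids : Avoids f y) where

  punchOutAvoided : Fin m → Fin n
  punchOutAvoided k = punchOut (avoids k ∘ sym)

  punchOutAvoided-injective : Injective _≡_ _≡_ f → Injective _≡_ _≡_ punchOutAvoided
  punchOutAvoided-injective f-inj e =
    f-inj (punchOut-injective (avoids _ ∘ sym) (avoids _ ∘ sym) e)

injective-avoiding⇒< : ∀ {m n} {f : Fin m → Fin n} → Injective _≡_ _≡_ f →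
                       ∀ {y} → Avoids f y → m < n
injective-avoiding⇒< {n = zero} _ {()} _
injective-avoiding⇒< {n = suc _} f-inj avoids =
  s≤s (injective⇒≤ (punchOutAvoided-injective avoids f-inj))

module _ {n : ℕ} {f : Fin n → Fin (suc n)} (f-inj : Injective _≡_ _≡_ f) where

  ∃-avoided : ∃ (Avoids f)
  ∃-avoided with any? (λ y → all? (λ k → ¬? (f k ≟ y)))
  ... | yes avoided = avoided
  ... | no ¬avoided = contradiction (injective⇒≤ {f = preimage} preimage-injective) (n≮n n)
    where
    hit : ∀ y → ∃ λ k → f k ≡ y
    hit y with any? (λ k → f k ≟ y)
    ... | yes found = found
    ... | no ¬found = contradiction (y , λ k e → ¬found (k , e)) ¬avoided
    preimage : Fin (suc n) → Fin n
    preimage = proj₁ ∘ hit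
    preimage-injective : Injective _≡_ _≡_ preimage
    preimage-injective {y} {y'} e =
      trans (sym (proj₂ (hit y))) (trans (cong f e) (proj₂ (hit y')))

  avoided-unique : ∀ {y y'} → Avoids f y → Avoids f y' → y ≡ y'
  avoided-unique {y} {y'} avoids avoids' with y ≟ y'
  ... | yes y≡y' = y≡y'
  ... | no y≢y' = contradiction
    (injective-avoiding⇒< (punchOutAvoided-injective avoids f-inj) {punchOut y≢y'}
       (λ k e → avoids' k (punchOut-injective {i = y} _ _ e)))
    (n≮n n)

  hit-unless-avoided : ∀ {y} → Avoids f y → ∀ x → x ≢ y → ∃ λ k → f k ≡ x
  hit-unless-avoided avoids x x≢y with any? (λ k → f k ≟ x)
  ... | yes found = found
  ... | no ¬found = contradiction (avoided-unique (λ k e → ¬found (k , e)) avoids) x≢y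

module _ {m t p : ℕ} {part : Bool → Fin m → Fin p → Fin t} {sn : Bool → Fin m → Fin t}
         {c : V m t (suc p) → Fin (suc p)} (proper : Proper part sn c) (b : Bool) where

  cliqueColouring : Fin m → Fin p → Fin (suc p)
  cliqueColouring i k = c (C b i k)

  cliqueColouring-injective : ∀ i → Injective _≡_ _≡_ (cliqueColouring i)
  cliqueColouring-injective i {k} {k'} ck≡ck' with k ≟ k'
  ... | yes k≡k' = k≡k'
  ... | no k≢k' = contradiction ck≡ck' (proper _ _ (inj₁ (cc b i k k' k≢k')))

  clique-avoids-independent : ∀ i j → Avoids (cliqueColouring i) (c (I b i j))
  clique-avoids-independent i j k = proper _ _ (inj₁ (ci b i k j))

  independent-coloured-avoided : ∀ {i a} → Avoids (cliqueColouring i) a →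
                                 ∀ j → c (I b i j) ≡ a
  independent-coloured-avoided {i} avoids j =
    avoided-unique (cliqueColouring-injective i) (clique-avoids-independent i j) avoids

  avoided-propagates : ∀ {i i' a} → toℕ i' ≡ suc (toℕ i) →
                       Avoids (cliqueColouring i) a → Avoids (cliqueColouring i') a
  avoided-propagates {i} {i'} i'≡1+i avoids k ck≡a =
    proper _ _ (inj₁ (ic b i i' (part b i' k) k i'≡1+i refl))
      (trans (independent-coloured-avoided avoids _) (sym ck≡a))

lemma7 : (q m t : ℕ) → 1 ≤ m → .{{_ : NonZero t}} → 3 ≤ q → t < q →
         (part : Bool → Fin m → Fin (q ∸ 1) → Fin t) → Balanced m t q part →
         (sn : Bool → Fin m → Fin t) →
         (c : V m t q → Fin q) → Proper part sn c →
         (b : Bool) →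
         ∃ λ (a : Fin q) →
           ((i : Fin m) (k : Fin (q ∸ 1)) → c (C b i k) ≢ a)
           × ((i : Fin m) (x : Fin q) → x ≢ a → ∃ λ (k : Fin (q ∸ 1)) → c (C b i k) ≡ x)
           × ((i : Fin m) (j : Fin t) → c (I b i j) ≡ a)
lemma7 (suc p) (suc m) t (s≤s z≤n) (s≤s _) _ part _ sn c proper b =
  a , avoids , (λ i → hit-unless-avoided (cliqueColouring-injective proper b i) (avoids i))
    , (λ i → independent-coloured-avoided proper b (avoids i))
  where
  first-avoided : ∃ (Avoids (cliqueColouring proper b Fin.zero))
  first-avoided = ∃-avoided (cliqueColouring-injective proper b Fin.zero)
  a : Fin (suc p)
  a = proj₁ first-avoided
  avoids : ∀ i → Avoids (cliqueColouring proper b i) a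
  avoids = <-weakInduction (λ i → Avoids (cliqueColouring proper b i) a) (proj₂ first-avoided)
    (λ i → avoided-propagates proper b (cong suc (sym (toℕ-inject₁ i))))
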